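{- Let $p>1$ be an integer and let $\mathcal{C}_p$ be the weighted cycle of Type 1, i.e. with weight word $zx^{p-1}$ (vertex $0$ has weight $z$ and vertices $1,\dots,p-1$ have weight $x$). Then every coloring $\varphi:\{0,\dots,p-1\}\to\{\bullet,\circ\}$ is a constant $2$-labelling of $\mathcal{C}_p$.
   Context: A weighted cycle $\mathcal{C}_p$ has vertices $0,\dots,p-1$ ($i$ adjacent to $i\pm1 \bmod p$) with real weights $w(0),\dots,w(p-1)$, represented by the word $w(0)w(1)\cdots w(p-1)$. For $k\in\mathbb{Z}$, $\mathcal{R}_k(i)=i+k\bmod p$. A coloring $\varphi:\{0,\dots,p-1\}\to\{\bullet,\circ\}$ is a constant $2$-labelling of $\mathcal{C}_p$ if the quantity $S(k):=\sum_{\{u\mid\varphi(\mathcal{R}_k(u))=\bullet\}} w(u)$ takes one common value $a$ for all $k$ with $\varphi(k)=\bullet$, and one common value $b$ for all $k$ with $\varphi(k)=\circ$ (this is the general notion with vertex $v=0$ and automorphism set $A=\{\mathcal{R}_k\mid k\in\mathbb{Z}\}$). -}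

module Defs where

open import Level using (Level)
open import Data.Nat using (ℕ; suc; _+_; NonZero)
open import Data.Nat.DivMod using (_mod_)
open import Data.Fin using (Fin; toℕ; zero; suc)
open import Data.Bool using (Bool; true; false; if_then_else_)
open import Data.Product using (Σ; _×_)
open import Relation.Binary.PropositionalEquality using (_≡_)
open import Algebra.Bundles using (CommutativeMonoid)

-- Colors: true = ● (black), false = ○ (white).
Color : Set
Color = Bool

rot : (p : ℕ) → .{{_ : NonZero p}} → Fin p → Fin p → Fin p
rot p k i = (toℕ i + toℕ k) mod p

module _ {c ℓ : Level} (M : CommutativeMonoid c ℓ) where
  open CommutativeMonoid M renaming (Carrier to W)

  ΣFin : (p : ℕ) → (Fin p → W) → W
  ΣFin ℕ.zero f = ε
  ΣFin (suc p) f = f zero ∙ ΣFin p (λ i → f (suc i))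

  S : (p : ℕ) → .{{_ : NonZero p}} → (Fin p → W) → (Fin p → Color) → Fin p → W
  S p w φ k = ΣFin p (λ u → if φ (rot p k u) then w u else ε)

  -- φ is a constant 2-labelling of the weighted cycle (C_p, w)
  -- w.r.t. v = 0 and A = {R_k}.
  IsConstant2Labelling : (p : ℕ) → .{{_ : NonZero p}} → (Fin p → W) → (Fin p → Color) → Set (c Level.⊔ ℓ)
  IsConstant2Labelling p w φ =
    Σ W λ a → Σ W λ b → (k : Fin p) →
      (φ k ≡ true → S p w φ k ≈ a) × (φ k ≡ false → S p w φ k ≈ b)

  type1 : (p : ℕ) → W → W → Fin p → W
  type1 p z x zero = z
  type1 p z x (suc _) = x

-- Vertex 0 is the only vertex of weight z, and R_k sends it to k, so
-- S(k) = [φ(k) = ●] z + r x, where r counts the black vertices R_k(u)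
-- with u ≠ 0. Rotations permute the vertices, so r + [φ(k) = ●] is the
-- total number C of black vertices. Hence S(k) = z + (C - 1) x when k is
-- black and S(k) = C x when k is white, independently of k.
module Submission where

open import Defs
open import Level using (Level)
open import Data.Nat using (ℕ; _<_; NonZero)
open import Data.Fin using (Fin)
open import Algebra.Bundles using (CommutativeMonoid)

open import Data.Nat using (zero; suc; pred; _+_; _∸_; _%_)
open import Data.Nat.Properties using (+-assoc; +-comm; m+[n∸m]≡n; <⇒≤; +-0-commutativeMonoid)
open import Data.Nat.DivMod using (_mod_; %-distribˡ-+; m%n%n≡m%n; [m+n]%n≡m%n; m<n⇒m%n≡m)
open import Data.Fin using (toℕ)
open import Data.Fin.Properties using (toℕ-injective; toℕ-fromℕ<; toℕ<n)
open import Data.Fin.Permutation using (Permutation; permutation)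
open import Data.Bool using (Bool; true; false; if_then_else_)
open import Data.Product using (_,_)
open import Function using (_∘_)
open import Relation.Binary.PropositionalEquality using (_≡_; refl; cong; cong₂; sym; trans; module ≡-Reasoning)
import Algebra.Properties.CommutativeMonoid.Sum as CommutativeMonoidSum
import Algebra.Definitions.RawMonoid as RawMonoidDefinitions

[[m+c]%n+d]%n≡m : ∀ m c d n .{{_ : NonZero n}} → m < n → c + d ≡ n → ((m + c) % n + d) % n ≡ m
[[m+c]%n+d]%n≡m m c d n m<n c+d≡n = begin
  ((m + c) % n + d) % n          ≡⟨ %-distribˡ-+ ((m + c) % n) d n ⟩
  ((m + c) % n % n + d % n) % n  ≡⟨ cong (λ t → (t + d % n) % n) (m%n%n≡m%n (m + c) n) ⟩
  ((m + c) % n + d % n) % n      ≡⟨ %-distribˡ-+ (m + c) d n ⟨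
  (m + c + d) % n                ≡⟨ cong (_% n) (trans (+-assoc m c d) (cong (m +_) c+d≡n)) ⟩
  (m + n) % n                    ≡⟨ [m+n]%n≡m%n m n ⟩
  m % n                          ≡⟨ m<n⇒m%n≡m m<n ⟩
  m                              ∎
  where open ≡-Reasoning

-- rot p k is definitionally shift p (toℕ k).
shift : (p : ℕ) .{{_ : NonZero p}} → ℕ → Fin p → Fin p
shift p c u = (toℕ u + c) mod p

shift-inverse : ∀ p .{{_ : NonZero p}} {c d} → c + d ≡ p → ∀ u → shift p d (shift p c u) ≡ u
shift-inverse p {c} {d} c+d≡p u = toℕ-injective (begin
  toℕ (shift p d (shift p c u))          ≡⟨ toℕ-fromℕ< _ ⟩
  (toℕ (shift p c u) + d) % p            ≡⟨ cong (λ t → (t + d) % p) (toℕ-fromℕ< _) ⟩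
  ((toℕ u + c) % p + d) % p              ≡⟨ [[m+c]%n+d]%n≡m (toℕ u) c d p (toℕ<n u) c+d≡p ⟩
  toℕ u                                  ∎)
  where open ≡-Reasoning

rotation : ∀ p .{{_ : NonZero p}} → Fin p → Permutation p p
rotation p k = permutation (rot p k) (shift p (p ∸ toℕ k))
  (shift-inverse p (trans (+-comm (p ∸ toℕ k) (toℕ k)) k+[p∸k]≡p))
  (shift-inverse p k+[p∸k]≡p)
  where
  k+[p∸k]≡p : toℕ k + (p ∸ toℕ k) ≡ p
  k+[p∸k]≡p = m+[n∸m]≡n (<⇒≤ (toℕ<n k))

rot-zero : ∀ q (k : Fin (suc q)) → rot (suc q) k Fin.zero ≡ k
rot-zero q k = toℕ-injective (trans (toℕ-fromℕ< _) (m<n⇒m%n≡m (toℕ<n k)))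

indicator : Bool → ℕ
indicator b = if b then 1 else 0

module ℕSum = CommutativeMonoidSum +-0-commutativeMonoid

count : ∀ {n} → (Fin n → Bool) → ℕ
count χ = ℕSum.sum (indicator ∘ χ)

count-rot : ∀ p .{{_ : NonZero p}} (k : Fin p) (χ : Fin p → Bool) → count (χ ∘ rot p k) ≡ count χ
count-rot p k χ = sym (ℕSum.sum-permute (indicator ∘ χ) (rotation p k))

module _ {c ℓ : Level} (M : CommutativeMonoid c ℓ) where
  open CommutativeMonoid M
    using (_≈_; _∙_; ε; rawMonoid; setoid; ∙-congˡ; identityˡ)
    renaming (Carrier to W; refl to ≈-refl; trans to ≈-trans)
  open RawMonoidDefinitions rawMonoid using (_×_)
  open import Relation.Binary.Reasoning.Setoid setoid

  ΣFin-if-const : ∀ n (χ : Fin n → Bool) (x : W) → ΣFin M n (λ i → if χ i then x else ε) ≈ count χ × x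
  ΣFin-if-const zero    χ x = ≈-refl
  ΣFin-if-const (suc n) χ x with χ Fin.zero
  ... | true  = ∙-congˡ (ΣFin-if-const n (χ ∘ Fin.suc) x)
  ... | false = ≈-trans (identityˡ _) (ΣFin-if-const n (χ ∘ Fin.suc) x)

  -- S(k) for k of colour b, where C is the number of black vertices.
  type1-value : W → W → Bool → ℕ → W
  type1-value z x true  C = z ∙ (pred C × x)
  type1-value z x false C = C × x

  type1-value-split : ∀ z x b r → (if b then z else ε) ∙ (r × x) ≈ type1-value z x b (indicator b + r)
  type1-value-split z x true  r = ≈-refl
  type1-value-split z x false r = identityˡ (r × x)

  S-type1 : ∀ q z x (φ : Fin (suc q) → Bool) k →
    S M (suc q) (type1 M (suc q) z x) φ k ≈ type1-value z x (φ k) (count φ)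
  S-type1 q z x φ k = begin
    S M (suc q) (type1 M (suc q) z x) φ k
      ≈⟨ ∙-congˡ (ΣFin-if-const q (ψ ∘ Fin.suc) x) ⟩
    (if ψ Fin.zero then z else ε) ∙ (count (ψ ∘ Fin.suc) × x)
      ≈⟨ type1-value-split z x (ψ Fin.zero) (count (ψ ∘ Fin.suc)) ⟩
    type1-value z x (ψ Fin.zero) (count ψ)
      ≡⟨ cong₂ (type1-value z x) (cong φ (rot-zero q k)) (count-rot (suc q) k φ) ⟩
    type1-value z x (φ k) (count φ)
      ∎
    where
    ψ : Fin (suc q) → Bool
    ψ = φ ∘ rot (suc q) k

lemma1p1 : {c ℓ : Level} (M : CommutativeMonoid c ℓ) →
    (p : ℕ) → .{{_ : NonZero p}} → 1 < p →
    (z x : CommutativeMonoid.Carrier M) → (φ : Fin p → Color) →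
    IsConstant2Labelling M p (type1 M p z x) φ
lemma1p1 M (suc q) _ z x φ = value true , value false , λ k → at k , at k
  where
  open CommutativeMonoid M using (_≈_)

  value : Bool → CommutativeMonoid.Carrier M
  value b = type1-value M z x b (count φ)

  at : ∀ k {b} → φ k ≡ b → S M (suc q) (type1 M (suc q) z x) φ k ≈ value b
  at k refl = S-type1 M q z x φ k
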